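{- Let $n\ge1$. The map $\alpha_n\times\varsigma_n:\big((\mathbb{Z}/2\mathbb{Z})^{n+1}\rtimes_Q\mathrm{Sym}(n+1)\big)\times\mathbb{D}_n\to\mathbb{D}_n$, $((b,\sigma),x)\mapsto\varsigma(b,\alpha''_n(\sigma,x))$, is a free group action: if $(\alpha_n\times\varsigma_n)((b,\sigma),x)=x$ for some $x$, then $(b,\sigma)=((0,\dots,0),\mathrm{id})$.
   Context: $\mathbb{N}^*=\mathbb{N}\setminus\{0\}$. $\mathrm{Sym}(n+1)$ is the group of bijections of $\{1,\dots,n+1\}$ with product $\sigma\cdot\rho:=\rho\circ\sigma$; $(n+1\ n+1)=\mathrm{id}$. Arithmetic in $\mathbb{Z}/2\mathbb{Z}$; $\delta_{i,j}$ Kronecker delta; vectors are columns. $Q(\sigma)_{i,j}=\delta_{(n+1\ \sigma(n+1))(\sigma(i)),\,j}+\delta_{\sigma(n+1),j}(1+\delta_{n+1,\sigma(i)})(1+\delta_{\sigma(n+1),n+1})$; $\sigma\mapsto Q(\sigma)$ is a morphism $\mathrm{Sym}(n+1)\to\mathrm{GL}((\mathbb{Z}/2\mathbb{Z})^{n+1})$. The semidirect product $(\mathbb{Z}/2\mathbb{Z})^{n+1}\rtimes_Q\mathrm{Sym}(n+1)$ has underlying set $(\mathbb{Z}/2\mathbb{Z})^{n+1}\times\mathrm{Sym}(n+1)$ and product $(b,\sigma)(b',\sigma')=(b+Q(\sigma)b',\sigma\cdot\sigma')$. $R(\sigma,v)=d^\sigma+Q(\sigma)v$ with $d^\sigma_j=(1+\delta_{n+1,\sigma(j)})(1+\delta_{n+1,\sigma(n+1)})$;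 $P_{\mathbb{N}^*}(\sigma)(k_1,\dots,k_{n+1})=(k_{\sigma(1)},\dots,k_{\sigma(n+1)})$. $\mathbb{D}_n=\mathrm{Sym}(n+1)\times(\mathbb{N}^*)^{n+1}\times(\mathbb{Z}/2\mathbb{Z})^{n+1}\times\mathbb{Z}/2\mathbb{Z}$; $\alpha''_n(\sigma,(\sigma',k,v,s))=(\sigma\cdot\sigma',P_{\mathbb{N}^*}(\sigma)(k),R(\sigma,v),s)$; $\varsigma(b,(\sigma',k,v,s))=(\sigma',k,b+v,s)$. -}

module Defs where

open import Data.Nat using (ℕ; suc; NonZero)
open import Data.Bool using (Bool; true; false; if_then_else_; not; _xor_; _∧_)
open import Data.Fin using (Fin; fromℕ; _≟_)
open import Data.Fin.Permutation using (Permutation′; _⟨$⟩ʳ_; _∘ₚ_)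
open import Data.Product using (Σ; _×_; _,_; proj₁)
open import Relation.Nullary.Decidable using (⌊_⌋)
open import Relation.Binary.PropositionalEquality using (_≡_)

-- ℤ/2ℤ is modelled by Bool, with addition = xor and multiplication = ∧.
ℤ₂ : Set
ℤ₂ = Bool

-- Throughout, the paper's {1,…,n+1} is Fin (suc n); the element n+1 is `top n`.
top : (n : ℕ) → Fin (suc n)
top n = fromℕ n

δ : ∀ {m} → Fin m → Fin m → ℤ₂
δ i j = ⌊ i ≟ j ⌋

-- Sym(n+1); product σ · ρ := ρ ∘ σ, which is exactly stdlib's σ ∘ₚ ρ
Sym : ℕ → Set
Sym n = Permutation′ (suc n)

_·_ : ∀ {n} → Sym n → Sym n → Sym n
σ · ρ = σ ∘ₚ ρ

Vec₂ : ℕ → Set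
Vec₂ m = Fin m → ℤ₂

_⊕_ : ∀ {m} → Vec₂ m → Vec₂ m → Vec₂ m
(u ⊕ v) i = u i xor v i

Σ₂ : ∀ {m} → (Fin m → ℤ₂) → ℤ₂
Σ₂ {ℕ.zero} f = false
Σ₂ {suc m} f = f Fin.zero xor Σ₂ (λ i → f (Fin.suc i))

swap : ∀ {m} → Fin m → Fin m → Fin m → Fin m
swap a b x = if δ x a then b else (if δ x b then a else x)

Qm : ∀ {n} → Sym n → Fin (suc n) → Fin (suc n) → ℤ₂
Qm {n} σ i j =
  δ (swap (top n) (σ ⟨$⟩ʳ top n) (σ ⟨$⟩ʳ i)) j
  xor (δ (σ ⟨$⟩ʳ top n) j ∧ (not (δ (top n) (σ ⟨$⟩ʳ i)) ∧ not (δ (σ ⟨$⟩ʳ top n) (top n))))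

Q : ∀ {n} → Sym n → Vec₂ (suc n) → Vec₂ (suc n)
Q σ v i = Σ₂ (λ j → Qm σ i j ∧ v j)

SDP : ℕ → Set
SDP n = Vec₂ (suc n) × Sym n

_⋆_ : ∀ {n} → SDP n → SDP n → SDP n
(b , σ) ⋆ (b′ , σ′) = (b ⊕ Q σ b′) , (σ · σ′)

d : ∀ {n} → Sym n → Vec₂ (suc n)
d {n} σ j = not (δ (top n) (σ ⟨$⟩ʳ j)) ∧ not (δ (top n) (σ ⟨$⟩ʳ top n))

R : ∀ {n} → Sym n → Vec₂ (suc n) → Vec₂ (suc n)
R σ v = d σ ⊕ Q σ v

ℕ* : Set
ℕ* = Σ ℕ NonZero

P : ∀ {n} → Sym n → (Fin (suc n) → ℕ*) → (Fin (suc n) → ℕ*)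
P σ k i = k (σ ⟨$⟩ʳ i)

𝔻 : ℕ → Set
𝔻 n = Sym n × (Fin (suc n) → ℕ*) × Vec₂ (suc n) × ℤ₂

α″ : ∀ {n} → Sym n → 𝔻 n → 𝔻 n
α″ σ (σ′ , k , v , s) = (σ · σ′) , P σ k , R σ v , s

ς : ∀ {n} → Vec₂ (suc n) → 𝔻 n → 𝔻 n
ς b (σ′ , k , v , s) = σ′ , k , (b ⊕ v) , s

act : ∀ {n} → SDP n → 𝔻 n → 𝔻 n
act (b , σ) x = ς b (α″ σ x)

_≈𝔻_ : ∀ {n} → 𝔻 n → 𝔻 n → Set
(σ , k , v , s) ≈𝔻 (σ′ , k′ , v′ , s′) =
  (∀ i → σ ⟨$⟩ʳ i ≡ σ′ ⟨$⟩ʳ i) × (∀ i → k i ≡ k′ i) × (∀ i → v i ≡ v′ i) × (s ≡ s′)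

e : ∀ {n} → SDP n
e = (λ _ → false) , Data.Fin.Permutation.id

IsNeutral : ∀ {n} → SDP n → Set
IsNeutral (b , σ) = (∀ i → b i ≡ false) × (∀ i → σ ⟨$⟩ʳ i ≡ i)

IsGroupAction : ∀ {n} → (SDP n → 𝔻 n → 𝔻 n) → Set
IsGroupAction {n} a =
  (∀ (x : 𝔻 n) → a e x ≈𝔻 x) ×
  (∀ (g h : SDP n) (x : 𝔻 n) → a (g ⋆ h) x ≈𝔻 a g (a h x))

IsFree : ∀ {n} → (SDP n → 𝔻 n → 𝔻 n) → Set
IsFree {n} a = ∀ (g : SDP n) (x : 𝔻 n) → a g x ≈𝔻 x → IsNeutral g

{-# OPTIONS --safe #-}
module Submission where

-- Let S be the involutive shear v ↦ v + v_{n+1}·(𝟙 + e_{n+1}) and P(σ) v = v ∘ σ the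
-- permutation representation. Computing the rows of Q(σ) gives Q(σ) = S P(σ) S, so Q is
-- a morphism. Moreover d^σ = 𝟙 + Q(σ)𝟙, i.e. R(σ, v) = 𝟙 + Q(σ)(𝟙 + v): R is an affine
-- action with linear part Q, which makes α_n × ς_n an action of the semidirect product.
-- If (b, σ) fixes (σ′, k, v, s), then σ′ ∘ σ = σ′ forces σ = id, hence R(σ, v) = v and
-- b + v = v, so b = 0.

open import Defs
open import Data.Nat using (ℕ; _≤_; suc)
open import Data.Bool using (true; false; not; _xor_; _∧_)
open import Data.Bool.Properties
  using (xor-assoc; xor-identityʳ; not-involutive; not-distribˡ-xor;
         ∧-identityʳ; ∧-distribˡ-xor; xor-∧-commutativeRing)
open import Data.Bool.Solver using (module xor-∧-Solver)
open import Data.Fin using (Fin; zero; suc; _≟_)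
open import Data.Fin.Permutation using (Permutation′; _⟨$⟩ʳ_; id)
open import Data.Product using (_×_; _,_)
open import Function.Base using (_∘_)
open import Function.Bundles using (Injection)
open import Function.Properties.Inverse using (↔⇒↣)
open import Relation.Nullary using (yes; no; ¬_)
open import Relation.Nullary.Decidable using (isYes≗does; dec-true; dec-false)
open import Relation.Binary.PropositionalEquality
open import Algebra.Bundles using (CommutativeRing)
open import Algebra.Properties.AbelianGroup (CommutativeRing.+-abelianGroup xor-∧-commutativeRing)
  using (identityˡ-unique)
open xor-∧-Solver using (solve; _:+_; _:*_; _:=_; con)
open ≡-Reasoning

δ-refl : ∀ {m} (x : Fin m) → δ x x ≡ true
δ-refl x = trans (isYes≗does (x ≟ x)) (dec-true (x ≟ x) refl)

δ-≢ : ∀ {m} {x y : Fin m} → ¬ x ≡ y → δ x y ≡ false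
δ-≢ {x = x} {y} x≢y = trans (isYes≗does (x ≟ y)) (dec-false (x ≟ y) x≢y)

δ-sym : ∀ {m} (x y : Fin m) → δ x y ≡ δ y x
δ-sym x y with x ≟ y
... | yes refl = sym (δ-refl x)
... | no x≢y = sym (δ-≢ (x≢y ∘ sym))

-- Not definitional: ⌊_⌋ = isYes is stuck until x ≟ y itself is evaluated.
δ-suc : ∀ {m} (x y : Fin m) → δ (suc x) (suc y) ≡ δ x y
δ-suc x y with x ≟ y
... | yes _ = refl
... | no _ = refl

Σ₂-cong : ∀ {m} {f g : Fin m → ℤ₂} → (∀ j → f j ≡ g j) → Σ₂ f ≡ Σ₂ g
Σ₂-cong {ℕ.zero} f≗g = refl
Σ₂-cong {suc m} f≗g = cong₂ _xor_ (f≗g zero) (Σ₂-cong (f≗g ∘ suc))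

Σ₂-zero : ∀ {m} → Σ₂ {m} (λ _ → false) ≡ false
Σ₂-zero {ℕ.zero} = refl
Σ₂-zero {suc m} = Σ₂-zero {m}

Σ₂-xor : ∀ {m} (f g : Fin m → ℤ₂) → Σ₂ (λ j → f j xor g j) ≡ Σ₂ f xor Σ₂ g
Σ₂-xor {ℕ.zero} f g = refl
Σ₂-xor {suc m} f g = begin
  (f zero xor g zero) xor Σ₂ (λ j → f (suc j) xor g (suc j))
    ≡⟨ cong ((f zero xor g zero) xor_) (Σ₂-xor (f ∘ suc) (g ∘ suc)) ⟩
  (f zero xor g zero) xor (Σ₂ (f ∘ suc) xor Σ₂ (g ∘ suc))
    ≡⟨ interchange (f zero) (g zero) (Σ₂ (f ∘ suc)) (Σ₂ (g ∘ suc)) ⟩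
  (f zero xor Σ₂ (f ∘ suc)) xor (g zero xor Σ₂ (g ∘ suc)) ∎
  where
  interchange : ∀ w x y z → (w xor x) xor (y xor z) ≡ (w xor y) xor (x xor z)
  interchange = solve 4 (λ w x y z → (w :+ x) :+ (y :+ z) := (w :+ y) :+ (x :+ z)) refl

Σ₂-δ : ∀ {m} (x : Fin m) (v : Fin m → ℤ₂) → Σ₂ (λ j → δ x j ∧ v j) ≡ v x
Σ₂-δ {suc m} zero v = trans (cong (v zero xor_) (Σ₂-zero {m})) (xor-identityʳ (v zero))
Σ₂-δ (suc x) v = trans (Σ₂-cong (λ j → cong (_∧ v (suc j)) (δ-suc x j))) (Σ₂-δ x (v ∘ suc))

Σ₂-δ⊕δ : ∀ {m} (x y : Fin m) (c : ℤ₂) (v : Vec₂ m) →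
         Σ₂ (λ j → (δ x j xor (δ y j ∧ c)) ∧ v j) ≡ v x xor (c ∧ v y)
Σ₂-δ⊕δ x y c v = begin
  Σ₂ (λ j → (δ x j xor (δ y j ∧ c)) ∧ v j)
    ≡⟨ Σ₂-cong (λ j → distrib (δ x j) (δ y j) c (v j)) ⟩
  Σ₂ (λ j → (δ x j ∧ v j) xor (δ y j ∧ (c ∧ v j)))
    ≡⟨ Σ₂-xor (λ j → δ x j ∧ v j) (λ j → δ y j ∧ (c ∧ v j)) ⟩
  Σ₂ (λ j → δ x j ∧ v j) xor Σ₂ (λ j → δ y j ∧ (c ∧ v j))
    ≡⟨ cong₂ _xor_ (Σ₂-δ x v) (Σ₂-δ y (λ j → c ∧ v j)) ⟩
  v x xor (c ∧ v y) ∎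
  where
  distrib : ∀ p q c w → (p xor (q ∧ c)) ∧ w ≡ (p ∧ w) xor (q ∧ (c ∧ w))
  distrib = solve 4 (λ p q c w → (p :+ q :* c) :* w := p :* w :+ q :* (c :* w)) refl

shear : ∀ {m} → Fin m → Vec₂ m → Vec₂ m
shear t v i = v i xor (not (δ i t) ∧ v t)

shear-cong : ∀ {m} (t : Fin m) {u w : Vec₂ m} → (∀ j → u j ≡ w j) → ∀ i → shear t u i ≡ shear t w i
shear-cong t u≗w i = cong₂ (λ p q → p xor (not (δ i t) ∧ q)) (u≗w i) (u≗w t)

shear-involutive : ∀ {m} (t : Fin m) (v : Vec₂ m) i → shear t (shear t v) i ≡ v i
shear-involutive t v i rewrite δ-refl t = cancel (v i) (not (δ i t)) (v t)
  where
  cancel : ∀ x c y → (x xor (c ∧ y)) xor (c ∧ (y xor false)) ≡ x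
  cancel = solve 3 (λ x c y → (x :+ (c :* y)) :+ (c :* (y :+ con false)) := x) refl

permute : ∀ {m} → Permutation′ m → Vec₂ m → Vec₂ m
permute π v i = v (π ⟨$⟩ʳ i)

complement : ∀ {m} → Vec₂ m → Vec₂ m
complement v i = not (v i)

permutation-injective : ∀ {m} (π : Permutation′ m) {x y : Fin m} → π ⟨$⟩ʳ x ≡ π ⟨$⟩ʳ y → x ≡ y
permutation-injective π = Injection.injective (↔⇒↣ π)

-- For y = π i and a = π t this says that row i of the matrix Q, whose row i is
-- e_{swap t a y} + [y ≠ t][a ≠ t]·e_a, agrees with S P(π) S.
swap-row≡shear : ∀ {m} (v : Vec₂ m) (t i y a : Fin m) → (i ≡ t → y ≡ a) → (y ≡ a → i ≡ t) →
  v (swap t a y) xor ((not (δ t y) ∧ not (δ a t)) ∧ v a) ≡ shear t v y xor (not (δ i t) ∧ shear t v a)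
swap-row≡shear v t i y a i≡t⇒y≡a y≡a⇒i≡t with i ≟ t
swap-row≡shear v t i y a i≡t⇒y≡a y≡a⇒i≡t | yes refl with refl ← i≡t⇒y≡a refl with y ≟ t
... | yes refl rewrite δ-refl t =
  solve 1 (λ x → x :+ con false := (x :+ con false) :+ con false) refl (v t)
... | no y≢t rewrite δ-refl y | δ-≢ (y≢t ∘ sym) =
  solve 2 (λ x z → x :+ z := (z :+ x) :+ con false) refl (v t) (v y)
swap-row≡shear v t i y a i≡t⇒y≡a y≡a⇒i≡t | no i≢t with y ≟ t
... | yes refl rewrite δ-refl y | δ-≢ (i≢t ∘ y≡a⇒i≡t ∘ sym) =
  solve 2 (λ x z → z :+ con false := (x :+ con false) :+ (z :+ x)) refl (v y) (v a)
... | no y≢t with a ≟ t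
...   | yes refl rewrite δ-≢ y≢t | δ-≢ (y≢t ∘ sym) =
  solve 2 (λ x z → x :+ con false := (x :+ z) :+ (z :+ con false)) refl (v y) (v a)
...   | no a≢t rewrite δ-≢ (i≢t ∘ y≡a⇒i≡t) | δ-≢ (y≢t ∘ sym) =
  solve 3 (λ x z w → x :+ w := (x :+ z) :+ (w :+ z)) refl (v y) (v t) (v a)

module _ {n : ℕ} where

  Q≡shear∘permute∘shear : (σ : Sym n) (v : Vec₂ (suc n)) (i : Fin (suc n)) →
                          Q σ v i ≡ shear (top n) (permute σ (shear (top n) v)) i
  Q≡shear∘permute∘shear σ v i = trans
    (Σ₂-δ⊕δ _ (σ ⟨$⟩ʳ top n) _ v)
    (swap-row≡shear v (top n) i (σ ⟨$⟩ʳ i) (σ ⟨$⟩ʳ top n) (cong (σ ⟨$⟩ʳ_)) (permutation-injective σ))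

  Q-cong : (σ : Sym n) {u w : Vec₂ (suc n)} → (∀ j → u j ≡ w j) → ∀ i → Q σ u i ≡ Q σ w i
  Q-cong σ u≗w i = Σ₂-cong (λ j → cong (Qm σ i j ∧_) (u≗w j))

  Q-linear : (σ : Sym n) (u w : Vec₂ (suc n)) (i : Fin (suc n)) → Q σ (u ⊕ w) i ≡ Q σ u i xor Q σ w i
  Q-linear σ u w i = trans (Σ₂-cong (λ j → ∧-distribˡ-xor (Qm σ i j) (u j) (w j)))
                           (Σ₂-xor (λ j → Qm σ i j ∧ u j) (λ j → Qm σ i j ∧ w j))

  Q-identity : (σ : Sym n) → (∀ i → σ ⟨$⟩ʳ i ≡ i) → (v : Vec₂ (suc n)) (i : Fin (suc n)) → Q σ v i ≡ v i
  Q-identity σ σ≗id v i = begin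
    Q σ v i                                               ≡⟨ Q≡shear∘permute∘shear σ v i ⟩
    shear (top n) (permute σ (shear (top n) v)) i         ≡⟨ shear-cong (top n) (cong (shear (top n) v) ∘ σ≗id) i ⟩
    shear (top n) (shear (top n) v) i                     ≡⟨ shear-involutive (top n) v i ⟩
    v i                                                   ∎

  Q-homomorphism : (σ σ′ : Sym n) (v : Vec₂ (suc n)) (i : Fin (suc n)) → Q (σ · σ′) v i ≡ Q σ (Q σ′ v) i
  Q-homomorphism σ σ′ v i = begin
    Q (σ · σ′) v i
      ≡⟨ Q≡shear∘permute∘shear (σ · σ′) v i ⟩
    shear t (permute σ (permute σ′ (shear t v))) i
      ≡⟨ shear-cong t (sym ∘ shear-involutive t (permute σ′ (shear t v)) ∘ (σ ⟨$⟩ʳ_)) i ⟩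
    shear t (permute σ (shear t (shear t (permute σ′ (shear t v))))) i
      ≡⟨ shear-cong t (λ j → shear-cong t (Q≡shear∘permute∘shear σ′ v) (σ ⟨$⟩ʳ j)) i ⟨
    shear t (permute σ (shear t (Q σ′ v))) i
      ≡⟨ Q≡shear∘permute∘shear σ (Q σ′ v) i ⟨
    Q σ (Q σ′ v) i ∎
    where t = top n

  d≡not-Q𝟙 : (σ : Sym n) (i : Fin (suc n)) → d σ i ≡ not (Q σ (λ _ → true) i)
  d≡not-Q𝟙 σ i = begin
    not (δ t (σ ⟨$⟩ʳ i)) ∧ not (δ t a)   ≡⟨ cong (λ b → not (δ t (σ ⟨$⟩ʳ i)) ∧ not b) (δ-sym t a) ⟩
    c                                     ≡⟨ ∧-identityʳ c ⟨
    c ∧ true                              ≡⟨ not-involutive (c ∧ true) ⟨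
    not (true xor (c ∧ true))             ≡⟨ cong not (Σ₂-δ⊕δ (swap t a (σ ⟨$⟩ʳ i)) a c (λ _ → true)) ⟨
    not (Q σ (λ _ → true) i)              ∎
    where
    t = top n
    a = σ ⟨$⟩ʳ t
    c = not (δ t (σ ⟨$⟩ʳ i)) ∧ not (δ a t)

  R≡complement∘Q∘complement : (σ : Sym n) (v : Vec₂ (suc n)) (i : Fin (suc n)) →
                              R σ v i ≡ not (Q σ (complement v) i)
  R≡complement∘Q∘complement σ v i = begin
    d σ i xor Q σ v i                          ≡⟨ cong (_xor Q σ v i) (d≡not-Q𝟙 σ i) ⟩
    not (Q σ (λ _ → true) i) xor Q σ v i       ≡⟨ not-distribˡ-xor (Q σ (λ _ → true) i) (Q σ v i) ⟨
    not (Q σ (λ _ → true) i xor Q σ v i)       ≡⟨ cong not (Q-linear σ (λ _ → true) v i) ⟨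
    not (Q σ (complement v) i)                 ∎

  R-homomorphism : (σ σ′ : Sym n) (v : Vec₂ (suc n)) (i : Fin (suc n)) →
                   R (σ · σ′) v i ≡ R σ (R σ′ v) i
  R-homomorphism σ σ′ v i = begin
    R (σ · σ′) v i                             ≡⟨ R≡complement∘Q∘complement (σ · σ′) v i ⟩
    not (Q (σ · σ′) (complement v) i)          ≡⟨ cong not (Q-homomorphism σ σ′ (complement v) i) ⟩
    not (Q σ (Q σ′ (complement v)) i)          ≡⟨ cong not (Q-cong σ complement-R i) ⟩
    not (Q σ (complement (R σ′ v)) i)          ≡⟨ R≡complement∘Q∘complement σ (R σ′ v) i ⟨
    R σ (R σ′ v) i                             ∎
    where
    complement-R : ∀ j → Q σ′ (complement v) j ≡ not (R σ′ v j)
    complement-R j = trans (sym (not-involutive _)) (cong not (sym (R≡complement∘Q∘complement σ′ v j)))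

  R-affine : (σ : Sym n) (b w : Vec₂ (suc n)) (i : Fin (suc n)) → R σ (b ⊕ w) i ≡ Q σ b i xor R σ w i
  R-affine σ b w i = begin
    d σ i xor Q σ (b ⊕ w) i                   ≡⟨ cong (d σ i xor_) (Q-linear σ b w i) ⟩
    d σ i xor (Q σ b i xor Q σ w i)           ≡⟨ xor-swapˡ (d σ i) (Q σ b i) (Q σ w i) ⟩
    Q σ b i xor (d σ i xor Q σ w i)           ∎
    where
    xor-swapˡ : ∀ x y z → x xor (y xor z) ≡ y xor (x xor z)
    xor-swapˡ = solve 3 (λ x y z → x :+ (y :+ z) := y :+ (x :+ z)) refl

  R-identity : (σ : Sym n) → (∀ i → σ ⟨$⟩ʳ i ≡ i) → (v : Vec₂ (suc n)) (i : Fin (suc n)) → R σ v i ≡ v i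
  R-identity σ σ≗id v i = begin
    R σ v i                       ≡⟨ R≡complement∘Q∘complement σ v i ⟩
    not (Q σ (complement v) i)    ≡⟨ cong not (Q-identity σ σ≗id (complement v) i) ⟩
    not (not (v i))               ≡⟨ not-involutive (v i) ⟩
    v i                           ∎

  act-identity : (x : 𝔻 n) → act e x ≈𝔻 x
  act-identity (_ , _ , v , _) = (λ _ → refl) , (λ _ → refl) , R-identity id (λ _ → refl) v , refl

  act-compose : (g h : SDP n) (x : 𝔻 n) → act (g ⋆ h) x ≈𝔻 act g (act h x)
  act-compose (b , σ) (b′ , σ′) (_ , _ , v , _) = (λ _ → refl) , (λ _ → refl) , v-part , refl
    where
    v-part : ∀ i → (b i xor Q σ b′ i) xor R (σ · σ′) v i ≡ b i xor R σ (b′ ⊕ R σ′ v) i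
    v-part i = begin
      (b i xor Q σ b′ i) xor R (σ · σ′) v i       ≡⟨ cong ((b i xor Q σ b′ i) xor_) (R-homomorphism σ σ′ v i) ⟩
      (b i xor Q σ b′ i) xor R σ (R σ′ v) i       ≡⟨ xor-assoc (b i) (Q σ b′ i) (R σ (R σ′ v) i) ⟩
      b i xor (Q σ b′ i xor R σ (R σ′ v) i)       ≡⟨ cong (b i xor_) (R-affine σ b′ (R σ′ v) i) ⟨
      b i xor R σ (b′ ⊕ R σ′ v) i                 ∎

  act-free : IsFree {n} act
  act-free (b , σ) (σ′ , _ , v , _) (σσ′≗σ′ , _ , bRv≗v , _) = b≗0 , σ≗id
    where
    σ≗id : ∀ i → σ ⟨$⟩ʳ i ≡ i
    σ≗id i = permutation-injective σ′ (σσ′≗σ′ i)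
    b≗0 : ∀ i → b i ≡ false
    b≗0 i = identityˡ-unique (b i) (v i) (trans (cong (b i xor_) (sym (R-identity σ σ≗id v i))) (bRv≗v i))

mainTheorem9 : (n : ℕ) → 1 ≤ n → IsGroupAction {n} act × IsFree {n} act
mainTheorem9 n _ = (act-identity , act-compose) , act-free
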